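{- Let $E$ be a finite nonempty set and $u:2^E\to\mathbb{R}$ ordinally w-concave. For $X\in 2^E$ let $\mathbf{C}_u(X)=\operatorname{Arg}\max\{u(Y)\mid Y\subseteq X\}$, and for $U\in 2^E$ let $\mathbf{C}_u^{ -1}(U)=\{X\in 2^E\mid U\in\mathbf{C}_u(X)\}$. Then for any $U\in 2^E$ with $\mathbf{C}_u^{ -1}(U)\neq\emptyset$ there exists a unique set $U^+\in 2^E$ such that $\mathbf{C}_u^{ -1}(U)=[U,U^+]=\{X\in 2^E\mid U\subseteq X\subseteq U^+\}$.
   Context: Notation: for $X\subseteq E$ and $x\in E\setminus X$, $X+x=X\cup\{x\}$; for $x\in X$, $X-x=X\setminus\{x\}$. The symbol $\emptyset$ is also used as a formal element not in $E$, with $X+\emptyset=X-\emptyset=X$. A function $u:2^E\to\mathbb{R}$ is ordinally w-concave if for every $X,X'\in 2^E$ with $X\neq X'$ there exist distinct $x\in(X\setminus X')\cup\{\emptyset\}$ and $x'\in(X'\setminus X)\cup\{\emptyset\}$ such that (i) $u(X)<u(X-x+x')$, or (ii) $u(X')<u(X'-x'+x)$, or (iii) $u(X)=u(X-x+x')$ and $u(X')=u(X'-x'+x)$. -}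

module Defs where

open import Level using (Level; _⊔_)
open import Data.Nat using (ℕ)
open import Data.Maybe using (Maybe; just; nothing)
open import Data.Fin using (Fin)
open import Data.Fin.Subset using (Subset; _∈_; _∉_; _⊆_; _∪_; _-_; ⁅_⁆)
open import Data.Product using (Σ; ∃; _×_; _,_)
open import Data.Sum using (_⊎_)
open import Data.Unit.Polymorphic using (⊤)
open import Relation.Binary.Bundles using (StrictTotalOrder)
open import Relation.Binary.PropositionalEquality using (_≡_; _≢_)

-- Elements of E ∪ {∅}: `nothing` plays the role of the formal element ∅.
-- X - x  (with X - ∅ = X)
_-ₒ_ : ∀ {n} → Subset n → Maybe (Fin n) → Subset n
X -ₒ nothing = X
X -ₒ just a  = X - a

_+ₒ_ : ∀ {n} → Subset n → Maybe (Fin n) → Subset n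
X +ₒ nothing = X
X +ₒ just a  = X ∪ ⁅ a ⁆

InDiffOrEmpty : ∀ {n} → Maybe (Fin n) → Subset n → Subset n → Set
InDiffOrEmpty nothing  X X' = ⊤
InDiffOrEmpty (just a) X X' = a ∈ X × a ∉ X'

module _ {c ℓ₁ ℓ₂ : Level} (S : StrictTotalOrder c ℓ₁ ℓ₂) where
  open StrictTotalOrder S renaming (Carrier to V)

  OrdinallyWConcave : ∀ {n} → (Subset n → V) → Set (ℓ₁ ⊔ ℓ₂)
  OrdinallyWConcave {n} u =
    ∀ (X X' : Subset n) → X ≢ X' →
    Σ (Maybe (Fin n)) λ x → Σ (Maybe (Fin n)) λ x' →
      InDiffOrEmpty x X X' × InDiffOrEmpty x' X' X × x ≢ x' ×
      ( u X < u ((X -ₒ x) +ₒ x')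
      ⊎ u X' < u ((X' -ₒ x') +ₒ x)
      ⊎ (u X ≈ u ((X -ₒ x) +ₒ x') × u X' ≈ u ((X' -ₒ x') +ₒ x)))

  InChoice : ∀ {n} → (Subset n → V) → Subset n → Subset n → Set (ℓ₁ ⊔ ℓ₂)
  InChoice {n} u X U = U ⊆ X × (∀ (Y : Subset n) → Y ⊆ X → (u Y < u U ⊎ u Y ≈ u U))

  InChoiceInv : ∀ {n} → (Subset n → V) → Subset n → Subset n → Set (ℓ₁ ⊔ ℓ₂)
  InChoiceInv u U X = InChoice u X U

{-# OPTIONS --safe #-}

-- Let U⁺ be the set of i with U ∈ C_u(U + i). If U ∈ C_u(X) then every U + i ⊆ X has U ∈ C_u(U + i),
-- so X ⊆ U⁺. Conversely, for U ⊆ X ⊆ U⁺ and Y ⊆ X with Y ≠ U, w-concavity applied to (U, Y) gives an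
-- exchange Y' = Y - x' + x with x ∈ U ∖ Y, x' ∈ Y ∖ U: the alternative u U < u (U - x + x') is ruled out
-- since U - x + x' ⊆ U + x' and x' ∈ U⁺, and the others give u Y ≤ u Y'. As Y' is strictly closer to U
-- in Hamming distance, induction yields u Y ≤ u U. A nonempty interval determines its upper end.
module Submission where

open import Defs
open import Level using (Level)
open import Data.Bool using (if_then_else_; _xor_)
import Data.Bool as Bool
open import Data.Empty using (⊥-elim)
open import Data.Fin using (Fin)
open import Data.Fin.Subset using (Subset; _⊆_; _∈_; _∉_; _∪_; _-_; ⁅_⁆; inside; outside)
open import Data.Fin.Subset.Properties
  using (⊆-refl; ⊆-trans; ⊆-antisym; _⊆?_; anySubset?; p⊆p∪q; q⊆p∪q; x∈p∪q⁻; x∈⁅y⁆⇒x≡y; p─q⊆p; p─⊥≡p; ∪-identityʳ)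
open import Data.Maybe using (just; nothing)
open import Data.Nat using (ℕ; suc; s≤s; _+_) renaming (_<_ to _<ℕ_)
open import Data.Nat.Induction using (<-wellFounded)
open import Data.Nat.Properties using (+-monoʳ-<; <-trans) renaming (≤-reflexive to ≤ℕ-reflexive)
open import Data.Product using (∃; ∃!; _×_; _,_; proj₁; proj₂)
open import Data.Sum using (inj₁; inj₂; [_,_]′)
open import Data.Vec using (_∷_; []; tabulate)
open import Data.Vec.Base using (here; there)
open import Data.Vec.Properties using (lookup∘tabulate; []=⇒lookup; lookup⇒[]=; ≡-dec)
open import Function using (_∘_; _on_)
open import Function.Bundles using (_⇔_; mk⇔; Equivalence)
open import Induction.WellFounded using (Acc; acc)
import Relation.Binary.Construct.On as On
open import Relation.Binary.Bundles using (StrictTotalOrder)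
import Relation.Binary.Properties.StrictTotalOrder as StrictTotalOrderProperties
open import Relation.Binary.PropositionalEquality using (_≡_; _≢_; refl; sym; trans; cong; subst)
open import Relation.Nullary using (¬_; Dec; yes; no; contradiction)
open import Relation.Nullary.Decidable using (does; proof; dec-true; decidable-stable; ¬?; _×-dec_; _→-dec_)
open import Relation.Nullary.Reflects using (Reflects; invert)
open import Relation.Unary using (Pred; Decidable)

private
  variable
    n : ℕ
    ℓ : Level
    i : Fin n
    p q W W′ Z : Subset n

allSubsets? : {P : Pred (Subset n) ℓ} → Decidable P → Dec (∀ p → P p)
allSubsets? P? with anySubset? (¬? ∘ P?)
... | yes (p , ¬Pp) = no λ ∀P → ¬Pp (∀P p)
... | no ∄¬P        = yes λ p → decidable-stable (P? p) (λ ¬Pp → ∄¬P (p , ¬Pp))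

select : {P : Pred (Fin n) ℓ} → Decidable P → Subset n
select P? = tabulate (does ∘ P?)

∈-select : {P : Pred (Fin n) ℓ} (P? : Decidable P) → i ∈ select P? ⇔ P i
∈-select {i = i} P? = mk⇔
  (λ i∈ → invert (subst (Reflects _) (trans (sym (lookup∘tabulate _ i)) ([]=⇒lookup i∈)) (proof (P? i))))
  (λ Pi → lookup⇒[]= i _ (trans (lookup∘tabulate _ i) (dec-true (P? i) Pi)))

∪-least : p ⊆ W → q ⊆ W → p ∪ q ⊆ W
∪-least {p = p} {q = q} p⊆W q⊆W = [ p⊆W , q⊆W ]′ ∘ x∈p∪q⁻ p q

⁅⁆-⊆ : i ∈ W → ⁅ i ⁆ ⊆ W
⁅⁆-⊆ {i = i} {W = W} i∈W j∈⁅i⁆ = subst (_∈ W) (sym (x∈⁅y⁆⇒x≡y i j∈⁅i⁆)) i∈W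

-ₒ-⊆ : ∀ (p : Subset n) x → p -ₒ x ⊆ p
-ₒ-⊆ p nothing  = ⊆-refl
-ₒ-⊆ p (just i) = p─q⊆p p ⁅ i ⁆

+ₒ-monoˡ-⊆ : ∀ x → p ⊆ q → p +ₒ x ⊆ q +ₒ x
+ₒ-monoˡ-⊆ nothing  p⊆q = p⊆q
+ₒ-monoˡ-⊆ (just i) p⊆q = ∪-least (⊆-trans p⊆q (p⊆p∪q _)) (q⊆p∪q _ _)

+ₒ-least : ∀ x → p ⊆ W → q ⊆ W → InDiffOrEmpty x q W′ → p +ₒ x ⊆ W
+ₒ-least nothing  p⊆W _   _         = p⊆W
+ₒ-least (just i) p⊆W q⊆W (i∈q , _) = ∪-least p⊆W (⁅⁆-⊆ (q⊆W i∈q))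

hamming : Subset n → Subset n → ℕ
hamming []      []      = 0
hamming (x ∷ p) (y ∷ q) = (if x xor y then 1 else 0) + hamming p q

hamming-remove-< : i ∈ p → i ∉ q → hamming (p - i) q <ℕ hamming p q
hamming-remove-< {p = inside ∷ p} {outside ∷ q} here _ =
  s≤s (≤ℕ-reflexive (cong (λ r → hamming r q) (p─⊥≡p p)))
hamming-remove-< {q = inside ∷ _} here i∉q = contradiction here i∉q
hamming-remove-< {q = _ ∷ _} (there i∈p) i∉q = +-monoʳ-< _ (hamming-remove-< i∈p (i∉q ∘ there))

hamming-insert-< : i ∉ p → i ∈ q → hamming (p ∪ ⁅ i ⁆) q <ℕ hamming p q
hamming-insert-< {p = outside ∷ p} {inside ∷ q} _ here =
  s≤s (≤ℕ-reflexive (cong (λ r → hamming r q) (∪-identityʳ p)))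
hamming-insert-< {p = inside ∷ _} i∉p here = contradiction here i∉p
hamming-insert-< {p = inside ∷ _}  {_ ∷ _} i∉p (there i∈q) = +-monoʳ-< _ (hamming-insert-< (i∉p ∘ there) i∈q)
hamming-insert-< {p = outside ∷ _} {_ ∷ _} i∉p (there i∈q) = +-monoʳ-< _ (hamming-insert-< (i∉p ∘ there) i∈q)

hamming-exchange-< : ∀ x x′ → InDiffOrEmpty x q p → InDiffOrEmpty x′ p q → x ≢ x′ →
                     hamming ((p -ₒ x′) +ₒ x) q <ℕ hamming p q
hamming-exchange-< nothing  nothing  _                 _                 x≢x′ = contradiction refl x≢x′
hamming-exchange-< nothing  (just j) _                 (j∈p , j∉q)       _    = hamming-remove-< j∈p j∉q
hamming-exchange-< (just i) nothing  (i∈q , i∉p)       _                 _    = hamming-insert-< i∉p i∈q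
hamming-exchange-< {p = p} (just i) (just j) (i∈q , i∉p) (j∈p , j∉q) _ =
  <-trans (hamming-insert-< (i∉p ∘ p─q⊆p p ⁅ j ⁆) i∈q) (hamming-remove-< j∈p j∉q)

infix 4 _≐[_,_]
_≐[_,_] : Pred (Subset n) ℓ → Subset n → Subset n → Set ℓ
P ≐[ U , W ] = ∀ X → P X ⇔ (U ⊆ X × X ⊆ W)

≐-upper-unique : {P : Pred (Subset n) ℓ} {U : Subset n} → ∃ P → P ≐[ U , W ] → P ≐[ U , W′ ] → W ≡ W′
≐-upper-unique {P = P} {U = U} (X , PX) P≐[U,W] P≐[U,W′] =
  ⊆-antisym (upper-⊆ P≐[U,W] P≐[U,W′]) (upper-⊆ P≐[U,W′] P≐[U,W])
  where
  upper-⊆ : P ≐[ U , W ] → P ≐[ U , W′ ] → W ⊆ W′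
  upper-⊆ {W = W} P≐[U,W] P≐[U,W′] =
    let U⊆X , X⊆W = Equivalence.to (P≐[U,W] X) PX
    in proj₂ (Equivalence.to (P≐[U,W′] W) (Equivalence.from (P≐[U,W] W) (⊆-trans U⊆X X⊆W , ⊆-refl)))

module _ {c ℓ₁ ℓ₂ : Level} (S : StrictTotalOrder c ℓ₁ ℓ₂) where
  open StrictTotalOrder S using (_<_; asym; irrefl; module Eq) renaming (Carrier to V)
  open StrictTotalOrderProperties S using (_≤_; _≤?_)
    renaming (refl to ≤-refl; trans to ≤-trans; reflexive to ≤-reflexive)

  <⇒≱ : ∀ {a b} → a < b → ¬ (b ≤ a)
  <⇒≱ a<b (inj₁ b<a) = asym a<b b<a
  <⇒≱ a<b (inj₂ b≈a) = irrefl (Eq.sym b≈a) a<b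

  module _ (u : Subset n → V) where

    InChoice? : ∀ X U → Dec (InChoice S u X U)
    InChoice? X U = U ⊆? X ×-dec allSubsets? (λ Y → Y ⊆? X →-dec u Y ≤? u U)

    InChoice-restrict : ∀ {X U} → InChoice S u X U → U ⊆ Z → Z ⊆ X → InChoice S u Z U
    InChoice-restrict (_ , U-max) U⊆Z Z⊆X = U⊆Z , λ Y Y⊆Z → U-max Y (⊆-trans Y⊆Z Z⊆X)

    upper : Subset n → Subset n
    upper U = select (λ i → InChoice? (U ∪ ⁅ i ⁆) U)

    ∈-upper : ∀ {U} → i ∈ upper U ⇔ InChoice S u (U ∪ ⁅ i ⁆) U
    ∈-upper {U = U} = ∈-select (λ i → InChoice? (U ∪ ⁅ i ⁆) U)

    InChoiceInv⇒⊆-upper : ∀ {U X} → InChoiceInv S u U X → U ⊆ X × X ⊆ upper U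
    InChoiceInv⇒⊆-upper U∈CX@(U⊆X , _) = U⊆X , λ i∈X →
      Equivalence.from ∈-upper (InChoice-restrict U∈CX (p⊆p∪q _) (∪-least U⊆X (⁅⁆-⊆ i∈X)))

    module _ (wc : OrdinallyWConcave S u) {U X : Subset n} (U∈CU : InChoice S u U U) (U⊆X : U ⊆ X)
             (U∈C[U+i] : ∀ {i} → i ∈ X → InChoice S u (U ∪ ⁅ i ⁆) U) where

      private
        _⊏_ : Subset n → Subset n → Set
        _⊏_ = _<ℕ_ on (λ Y → hamming Y U)

        bounded : ∀ Y → Acc _⊏_ Y → Y ⊆ X → u Y ≤ u U
        bounded Y (acc descend) Y⊆X with ≡-dec Bool._≟_ Y U
        ... | yes refl = ≤-refl
        ... | no Y≢U with wc U Y (Y≢U ∘ sym)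
        ... | x , x′ , x∈U∖Y , x′∈Y∖U , x≢x′ , alternatives = conclude alternatives
          where
          Y′ : Subset n
          Y′ = (Y -ₒ x′) +ₒ x

          Y′-bounded : u Y′ ≤ u U
          Y′-bounded = bounded Y′ (descend (hamming-exchange-< x x′ x∈U∖Y x′∈Y∖U x≢x′))
            (+ₒ-least x (⊆-trans (-ₒ-⊆ Y x′) Y⊆X) U⊆X x∈U∖Y)

          U-max-+ₒ : ∀ y → InDiffOrEmpty y Y U → ∀ Z → Z ⊆ U +ₒ y → u Z ≤ u U
          U-max-+ₒ nothing  _         = proj₂ U∈CU
          U-max-+ₒ (just i) (i∈Y , _) = proj₂ (U∈C[U+i] (Y⊆X i∈Y))

          conclude : _ → u Y ≤ u U
          conclude (inj₁ U<) = ⊥-elim (<⇒≱ U< (U-max-+ₒ x′ x′∈Y∖U _ (+ₒ-monoˡ-⊆ x′ (-ₒ-⊆ U x))))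
          conclude (inj₂ (inj₁ Y<Y′)) = ≤-trans (inj₁ Y<Y′) Y′-bounded
          conclude (inj₂ (inj₂ (_ , Y≈Y′))) = ≤-trans (≤-reflexive Y≈Y′) Y′-bounded

      local⇒global-choice : InChoice S u X U
      local⇒global-choice =
        U⊆X , λ Y → bounded Y (On.wellFounded (λ Z → hamming Z U) <-wellFounded Y)

    InChoiceInv-interval : OrdinallyWConcave S u → ∀ {U} → InChoice S u U U →
                           InChoiceInv S u U ≐[ U , upper U ]
    InChoiceInv-interval wc U∈CU X = mk⇔
      InChoiceInv⇒⊆-upper
      (λ (U⊆X , X⊆U⁺) → local⇒global-choice wc U∈CU U⊆X (λ i∈X → Equivalence.to ∈-upper (X⊆U⁺ i∈X)))

theorem3p7 : ∀ {c ℓ₁ ℓ₂ : Level} (S : StrictTotalOrder c ℓ₁ ℓ₂) (n : ℕ)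
    (u : Subset (suc n) → StrictTotalOrder.Carrier S) →
    OrdinallyWConcave S u →
    ∀ (U : Subset (suc n)) →
    ∃ (λ X → InChoiceInv S u U X) →
    ∃! _≡_ (λ U⁺ → ∀ (X : Subset (suc n)) → (InChoiceInv S u U X ⇔ (U ⊆ X × X ⊆ U⁺)))
theorem3p7 S n u wc U C⁻¹U≠∅@(X , U∈CX) =
  upper S u U , C⁻¹U≐[U,U⁺] , ≐-upper-unique C⁻¹U≠∅ C⁻¹U≐[U,U⁺]
  where
  C⁻¹U≐[U,U⁺] : InChoiceInv S u U ≐[ U , upper S u U ]
  C⁻¹U≐[U,U⁺] = InChoiceInv-interval S u wc (InChoice-restrict S u U∈CX ⊆-refl (proj₁ U∈CX))
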